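{- Let $\mathbf{D}$ be a D-core algebra and $x,y,z\in D$. Then (a) $x\sqcap(y\sqcap z)=(x\sqcap y)\sqcap z$ and (b) $x\sqcup(y\sqcup z)=(x\sqcup y)\sqcup z$.
   Context: Write $x\vee y:=\neg(\neg x\sqcap\neg y)$ and $x\wedge y:=\lrcorner(\lrcorner x\sqcup\lrcorner y)$. A D-core algebra is an algebra $(D;\sqcap,\sqcup,\neg,\lrcorner,\top,\bot)$ of type $(2,2,1,1,0,0)$ satisfying, for all $x,y,z\in D$: $x\sqcap y=y\sqcap x$; $x\sqcup y=y\sqcup x$; $\neg(x\sqcap x)=\neg x$; $\lrcorner(x\sqcup x)=\lrcorner x$; $x\sqcap(x\sqcup y)=x\sqcap x$; $x\sqcup(x\sqcap y)=x\sqcup x$; $x\sqcap(y\vee z)=(x\sqcap y)\vee(x\sqcap z)$; $x\sqcup(y\wedge z)=(x\sqcup y)\wedge(x\sqcup z)$; $\neg\neg(x\sqcap y)=x\sqcap y$; $\lrcorner\lrcorner(x\sqcup y)=x\sqcup y$; $x\sqcap\neg x=\bot$; $x\sqcup\lrcorner x=\top$; $(x\sqcap x)\sqcup(x\sqcap x)=(x\sqcup x)\sqcap(x\sqcup x)$. -}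

module Defs where

open import Level using (Level; suc)
open import Relation.Binary.PropositionalEquality using (_≡_)

record DCoreAlgebra (a : Level) : Set (suc a) where
  infixr 7 _⊓_
  infixr 6 _⊔_
  field
    D    : Set a
    _⊓_  : D → D → D
    _⊔_  : D → D → D
    ¬_   : D → D
    ⌟_   : D → D
    ⊤    : D
    ⊥    : D

  _∨_ : D → D → D
  x ∨ y = ¬ ((¬ x) ⊓ (¬ y))

  _∧_ : D → D → D
  x ∧ y = ⌟ ((⌟ x) ⊔ (⌟ y))

  field
    ⊓-comm     : ∀ x y → x ⊓ y ≡ y ⊓ x
    ⊔-comm     : ∀ x y → x ⊔ y ≡ y ⊔ x
    ¬-idem     : ∀ x → ¬ (x ⊓ x) ≡ ¬ x
    ⌟-idem     : ∀ x → ⌟ (x ⊔ x) ≡ ⌟ x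
    ⊓-absorb   : ∀ x y → x ⊓ (x ⊔ y) ≡ x ⊓ x
    ⊔-absorb   : ∀ x y → x ⊔ (x ⊓ y) ≡ x ⊔ x
    ⊓-distrib-∨ : ∀ x y z → x ⊓ (y ∨ z) ≡ (x ⊓ y) ∨ (x ⊓ z)
    ⊔-distrib-∧ : ∀ x y z → x ⊔ (y ∧ z) ≡ (x ⊔ y) ∧ (x ⊔ z)
    ¬¬-⊓       : ∀ x y → ¬ (¬ (x ⊓ y)) ≡ x ⊓ y
    ⌟⌟-⊔       : ∀ x y → ⌟ (⌟ (x ⊔ y)) ≡ x ⊔ y
    ⊓-¬        : ∀ x → x ⊓ (¬ x) ≡ ⊥
    ⊔-⌟        : ∀ x → x ⊔ (⌟ x) ≡ ⊤
    ⊓⊔-interchange : ∀ x → (x ⊓ x) ⊔ (x ⊓ x) ≡ (x ⊔ x) ⊓ (x ⊔ x)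

{-# OPTIONS --safe #-}
module Submission where

-- The ⊓-idempotent elements x ⊓ x, which include every meet x ⊓ y and every
-- ¬ x, behave like a Boolean algebra under ⊓, ∨, ¬ with bottom ⊥ and top
-- ⊤ ⊓ ⊤.  In a Boolean algebra an element u is determined by x ∨ u and (¬ x) ∨ u,
-- and both x ∨ - and (¬ x) ∨ - take the same value on x ⊓ (y ⊓ z) and on
-- (x ⊓ y) ⊓ z.  Associativity of ⊔ is the same statement for the dual algebra.

open import Defs
open import Level using (Level)
open import Data.Product using (_×_; _,_)
open import Relation.Binary.PropositionalEquality
  using (_≡_; sym; trans; cong; cong₂; module ≡-Reasoning)

module DCoreAlgebraProperties {a : Level} (A : DCoreAlgebra a) where
  open DCoreAlgebra A
  open ≡-Reasoning

  ¬¬x≡x⊓x : ∀ x → ¬ ¬ x ≡ x ⊓ x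
  ¬¬x≡x⊓x x = trans (cong ¬_ (sym (¬-idem x))) (¬¬-⊓ x x)

  square-⊓ : ∀ x y → (x ⊓ y) ⊓ (x ⊓ y) ≡ x ⊓ y
  square-⊓ x y = trans (sym (¬¬x≡x⊓x (x ⊓ y))) (¬¬-⊓ x y)

  square-¬ : ∀ x → ¬ x ⊓ ¬ x ≡ ¬ x
  square-¬ x = trans (sym (¬¬x≡x⊓x (¬ x))) (trans (cong ¬_ (¬¬x≡x⊓x x)) (¬-idem x))

  ∨-comm : ∀ x y → x ∨ y ≡ y ∨ x
  ∨-comm x y = cong ¬_ (⊓-comm (¬ x) (¬ y))

  ∨-idem : ∀ x → x ∨ x ≡ x ⊓ x
  ∨-idem x = trans (¬-idem (¬ x)) (¬¬x≡x⊓x x)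

  ∨-absorbs-squareˡ : ∀ x y → (x ⊓ x) ∨ y ≡ x ∨ y
  ∨-absorbs-squareˡ x y = cong (λ t → ¬ (t ⊓ ¬ y)) (¬-idem x)

  ⊓-absorbs-squareʳ : ∀ x y → x ⊓ (y ⊓ y) ≡ x ⊓ y
  ⊓-absorbs-squareʳ x y = begin
    x ⊓ (y ⊓ y)        ≡⟨ cong (x ⊓_) (sym (∨-idem y)) ⟩
    x ⊓ (y ∨ y)        ≡⟨ ⊓-distrib-∨ x y y ⟩
    (x ⊓ y) ∨ (x ⊓ y)  ≡⟨ ∨-idem (x ⊓ y) ⟩
    (x ⊓ y) ⊓ (x ⊓ y)  ≡⟨ square-⊓ x y ⟩
    x ⊓ y              ∎

  ⊓-absorbs-squareˡ : ∀ x y → (x ⊓ x) ⊓ y ≡ x ⊓ y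
  ⊓-absorbs-squareˡ x y =
    trans (⊓-comm (x ⊓ x) y) (trans (⊓-absorbs-squareʳ y x) (⊓-comm y x))

  -- ⊤ need not be ⊓-idempotent; its square is the top of the idempotents.
  𝟙 : D
  𝟙 = ⊤ ⊓ ⊤

  x⊓⊤≡x⊓x : ∀ x → x ⊓ ⊤ ≡ x ⊓ x
  x⊓⊤≡x⊓x x = trans (cong (x ⊓_) (sym (⊔-⌟ x))) (⊓-absorb x (⌟ x))

  ⊓-identityʳ : ∀ x → x ⊓ 𝟙 ≡ x ⊓ x
  ⊓-identityʳ x = trans (⊓-absorbs-squareʳ x ⊤) (x⊓⊤≡x⊓x x)

  ⊓-identityˡ : ∀ x → 𝟙 ⊓ x ≡ x ⊓ x
  ⊓-identityˡ x = trans (⊓-comm 𝟙 x) (⊓-identityʳ x)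

  ⊥≡¬⊤ : ⊥ ≡ ¬ ⊤
  ⊥≡¬⊤ = begin
    ⊥           ≡⟨ sym (⊓-¬ ⊤) ⟩
    ⊤ ⊓ ¬ ⊤     ≡⟨ ⊓-comm ⊤ (¬ ⊤) ⟩
    ¬ ⊤ ⊓ ⊤     ≡⟨ x⊓⊤≡x⊓x (¬ ⊤) ⟩
    ¬ ⊤ ⊓ ¬ ⊤   ≡⟨ square-¬ ⊤ ⟩
    ¬ ⊤         ∎

  ¬⊥≡𝟙 : ¬ ⊥ ≡ 𝟙
  ¬⊥≡𝟙 = trans (cong ¬_ ⊥≡¬⊤) (¬¬x≡x⊓x ⊤)

  ∨-identityʳ : ∀ x → x ∨ ⊥ ≡ x ⊓ x
  ∨-identityʳ x = begin
    ¬ (¬ x ⊓ ¬ ⊥)  ≡⟨ cong (λ t → ¬ (¬ x ⊓ t)) ¬⊥≡𝟙 ⟩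
    ¬ (¬ x ⊓ 𝟙)    ≡⟨ cong ¬_ (trans (⊓-identityʳ (¬ x)) (square-¬ x)) ⟩
    ¬ ¬ x          ≡⟨ ¬¬x≡x⊓x x ⟩
    x ⊓ x          ∎

  ∨-complementʳ : ∀ x → x ∨ (¬ x) ≡ 𝟙
  ∨-complementʳ x = begin
    ¬ (¬ x ⊓ ¬ ¬ x)  ≡⟨ cong (λ t → ¬ (¬ x ⊓ t)) (¬¬x≡x⊓x x) ⟩
    ¬ (¬ x ⊓ (x ⊓ x))  ≡⟨ cong ¬_ (⊓-absorbs-squareʳ (¬ x) x) ⟩
    ¬ (¬ x ⊓ x)      ≡⟨ cong ¬_ (trans (⊓-comm (¬ x) x) (⊓-¬ x)) ⟩
    ¬ ⊥              ≡⟨ ¬⊥≡𝟙 ⟩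
    𝟙                ∎

  ∨-complementˡ : ∀ x → (¬ x) ∨ x ≡ 𝟙
  ∨-complementˡ x = trans (∨-comm (¬ x) x) (∨-complementʳ x)

  deMorgan : ∀ x y → ¬ (x ⊓ y) ≡ (¬ x) ∨ (¬ y)
  deMorgan x y = sym (cong ¬_ (begin
    ¬ ¬ x ⊓ ¬ ¬ y      ≡⟨ cong₂ _⊓_ (¬¬x≡x⊓x x) (¬¬x≡x⊓x y) ⟩
    (x ⊓ x) ⊓ (y ⊓ y)  ≡⟨ ⊓-absorbs-squareˡ x (y ⊓ y) ⟩
    x ⊓ (y ⊓ y)        ≡⟨ ⊓-absorbs-squareʳ x y ⟩
    x ⊓ y              ∎))

  ∨-distribˡ-⊓ : ∀ x y z → x ∨ (y ⊓ z) ≡ (x ∨ y) ⊓ (x ∨ z)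
  ∨-distribˡ-⊓ x y z = begin
    ¬ (¬ x ⊓ ¬ (y ⊓ z))        ≡⟨ cong (λ t → ¬ (¬ x ⊓ t)) (deMorgan y z) ⟩
    ¬ (¬ x ⊓ ((¬ y) ∨ (¬ z)))      ≡⟨ cong ¬_ (⊓-distrib-∨ (¬ x) (¬ y) (¬ z)) ⟩
    ¬ ¬ ((x ∨ y) ⊓ (x ∨ z))    ≡⟨ ¬¬-⊓ (x ∨ y) (x ∨ z) ⟩
    (x ∨ y) ⊓ (x ∨ z)          ∎

  ∨-zeroˡ : ∀ x → 𝟙 ∨ x ≡ 𝟙
  ∨-zeroˡ x = begin
    𝟙 ∨ x                  ≡⟨ ∨-comm 𝟙 x ⟩
    x ∨ 𝟙                  ≡⟨ sym (trans (⊓-identityʳ (x ∨ 𝟙)) (square-¬ _)) ⟩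
    (x ∨ 𝟙) ⊓ 𝟙            ≡⟨ cong ((x ∨ 𝟙) ⊓_) (sym (∨-complementʳ x)) ⟩
    (x ∨ 𝟙) ⊓ (x ∨ (¬ x))    ≡⟨ sym (∨-distribˡ-⊓ x 𝟙 (¬ x)) ⟩
    x ∨ (𝟙 ⊓ ¬ x)          ≡⟨ cong (x ∨_) (trans (⊓-identityˡ (¬ x)) (square-¬ x)) ⟩
    x ∨ (¬ x)                ≡⟨ ∨-complementʳ x ⟩
    𝟙                      ∎

  ∨-absorbs-⊓ : ∀ x y → x ∨ (x ⊓ y) ≡ x ⊓ x
  ∨-absorbs-⊓ x y = begin
    x ∨ (x ⊓ y)            ≡⟨ sym (∨-absorbs-squareˡ x (x ⊓ y)) ⟩
    (x ⊓ x) ∨ (x ⊓ y)      ≡⟨ cong (_∨ (x ⊓ y)) (sym (⊓-identityʳ x)) ⟩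
    (x ⊓ 𝟙) ∨ (x ⊓ y)      ≡⟨ sym (⊓-distrib-∨ x 𝟙 y) ⟩
    x ⊓ (𝟙 ∨ y)            ≡⟨ cong (x ⊓_) (∨-zeroˡ y) ⟩
    x ⊓ 𝟙                  ≡⟨ ⊓-identityʳ x ⟩
    x ⊓ x                  ∎

  ⊓-zeroʳ : ∀ x → x ⊓ ⊥ ≡ ⊥
  ⊓-zeroʳ x = begin
    x ⊓ ⊥                  ≡⟨ sym (trans (∨-identityʳ (x ⊓ ⊥)) (square-⊓ x ⊥)) ⟩
    (x ⊓ ⊥) ∨ ⊥            ≡⟨ cong ((x ⊓ ⊥) ∨_) (sym (⊓-¬ x)) ⟩
    (x ⊓ ⊥) ∨ (x ⊓ ¬ x)    ≡⟨ sym (⊓-distrib-∨ x ⊥ (¬ x)) ⟩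
    x ⊓ (⊥ ∨ (¬ x))          ≡⟨ cong (x ⊓_) (∨-comm ⊥ (¬ x)) ⟩
    x ⊓ ((¬ x) ∨ ⊥)          ≡⟨ cong (x ⊓_) (trans (∨-identityʳ (¬ x)) (square-¬ x)) ⟩
    x ⊓ ¬ x                ≡⟨ ⊓-¬ x ⟩
    ⊥                      ∎

  ⊓-absorbs-∨ : ∀ x y → x ⊓ (x ∨ y) ≡ x ⊓ x
  ⊓-absorbs-∨ x y = begin
    x ⊓ (x ∨ y)            ≡⟨ sym (⊓-absorbs-squareˡ x (x ∨ y)) ⟩
    (x ⊓ x) ⊓ (x ∨ y)      ≡⟨ cong (_⊓ (x ∨ y)) (sym (∨-identityʳ x)) ⟩
    (x ∨ ⊥) ⊓ (x ∨ y)      ≡⟨ sym (∨-distribˡ-⊓ x ⊥ y) ⟩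
    x ∨ (⊥ ⊓ y)            ≡⟨ cong (x ∨_) (trans (⊓-comm ⊥ y) (⊓-zeroʳ y)) ⟩
    x ∨ ⊥                  ≡⟨ ∨-identityʳ x ⟩
    x ⊓ x                  ∎

  ¬x∨x⊓y≡¬x∨y : ∀ x y → (¬ x) ∨ (x ⊓ y) ≡ (¬ x) ∨ y
  ¬x∨x⊓y≡¬x∨y x y = begin
    (¬ x) ∨ (x ⊓ y)              ≡⟨ ∨-distribˡ-⊓ (¬ x) x y ⟩
    ((¬ x) ∨ x) ⊓ ((¬ x) ∨ y)      ≡⟨ cong (_⊓ ((¬ x) ∨ y)) (∨-complementˡ x) ⟩
    𝟙 ⊓ ((¬ x) ∨ y)              ≡⟨ ⊓-identityˡ ((¬ x) ∨ y) ⟩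
    ((¬ x) ∨ y) ⊓ ((¬ x) ∨ y)      ≡⟨ square-¬ _ ⟩
    (¬ x) ∨ y                    ∎

  square-cancel : ∀ x u w → x ∨ u ≡ x ∨ w → (¬ x) ∨ u ≡ (¬ x) ∨ w → u ⊓ u ≡ w ⊓ w
  square-cancel x u w x∨u≡x∨w ¬x∨u≡¬x∨w = begin
    u ⊓ u                    ≡⟨ sym (∨-identityʳ u) ⟩
    u ∨ ⊥                    ≡⟨ cong (u ∨_) (sym (⊓-¬ x)) ⟩
    u ∨ (x ⊓ ¬ x)            ≡⟨ ∨-distribˡ-⊓ u x (¬ x) ⟩
    (u ∨ x) ⊓ (u ∨ (¬ x))      ≡⟨ cong₂ _⊓_ (flip x∨u≡x∨w) (flip ¬x∨u≡¬x∨w) ⟩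
    (w ∨ x) ⊓ (w ∨ (¬ x))      ≡⟨ sym (∨-distribˡ-⊓ w x (¬ x)) ⟩
    w ∨ (x ⊓ ¬ x)            ≡⟨ cong (w ∨_) (⊓-¬ x) ⟩
    w ∨ ⊥                    ≡⟨ ∨-identityʳ w ⟩
    w ⊓ w                    ∎
    where
    flip : ∀ {v} → v ∨ u ≡ v ∨ w → u ∨ v ≡ w ∨ v
    flip {v} e = trans (∨-comm u v) (trans e (∨-comm v w))

  ⊓-assoc : ∀ x y z → x ⊓ (y ⊓ z) ≡ (x ⊓ y) ⊓ z
  ⊓-assoc x y z = begin
    x ⊓ (y ⊓ z)                      ≡⟨ sym (square-⊓ x (y ⊓ z)) ⟩
    (x ⊓ (y ⊓ z)) ⊓ (x ⊓ (y ⊓ z))    ≡⟨ square-cancel x _ _ via-x via-¬x ⟩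
    ((x ⊓ y) ⊓ z) ⊓ ((x ⊓ y) ⊓ z)    ≡⟨ square-⊓ (x ⊓ y) z ⟩
    (x ⊓ y) ⊓ z                      ∎
    where
    via-x : x ∨ (x ⊓ (y ⊓ z)) ≡ x ∨ ((x ⊓ y) ⊓ z)
    via-x = begin
      x ∨ (x ⊓ (y ⊓ z))          ≡⟨ ∨-absorbs-⊓ x (y ⊓ z) ⟩
      x ⊓ x                      ≡⟨ sym (⊓-absorbs-∨ x z) ⟩
      x ⊓ (x ∨ z)                ≡⟨ sym (⊓-absorbs-squareˡ x (x ∨ z)) ⟩
      (x ⊓ x) ⊓ (x ∨ z)          ≡⟨ cong (_⊓ (x ∨ z)) (sym (∨-absorbs-⊓ x y)) ⟩
      (x ∨ (x ⊓ y)) ⊓ (x ∨ z)    ≡⟨ sym (∨-distribˡ-⊓ x (x ⊓ y) z) ⟩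
      x ∨ ((x ⊓ y) ⊓ z)          ∎
    via-¬x : (¬ x) ∨ (x ⊓ (y ⊓ z)) ≡ (¬ x) ∨ ((x ⊓ y) ⊓ z)
    via-¬x = begin
      (¬ x) ∨ (x ⊓ (y ⊓ z))            ≡⟨ ¬x∨x⊓y≡¬x∨y x (y ⊓ z) ⟩
      (¬ x) ∨ (y ⊓ z)                  ≡⟨ ∨-distribˡ-⊓ (¬ x) y z ⟩
      ((¬ x) ∨ y) ⊓ ((¬ x) ∨ z)          ≡⟨ cong (_⊓ ((¬ x) ∨ z)) (sym (¬x∨x⊓y≡¬x∨y x y)) ⟩
      ((¬ x) ∨ (x ⊓ y)) ⊓ ((¬ x) ∨ z)    ≡⟨ sym (∨-distribˡ-⊓ (¬ x) (x ⊓ y) z) ⟩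
      (¬ x) ∨ ((x ⊓ y) ⊓ z)            ∎

dual : {a : Level} → DCoreAlgebra a → DCoreAlgebra a
dual A = record
  { D = D ; _⊓_ = _⊔_ ; _⊔_ = _⊓_ ; ¬_ = ⌟_ ; ⌟_ = ¬_ ; ⊤ = ⊥ ; ⊥ = ⊤
  ; ⊓-comm = ⊔-comm ; ⊔-comm = ⊓-comm ; ¬-idem = ⌟-idem ; ⌟-idem = ¬-idem
  ; ⊓-absorb = ⊔-absorb ; ⊔-absorb = ⊓-absorb
  ; ⊓-distrib-∨ = ⊔-distrib-∧ ; ⊔-distrib-∧ = ⊓-distrib-∨
  ; ¬¬-⊓ = ⌟⌟-⊔ ; ⌟⌟-⊔ = ¬¬-⊓ ; ⊓-¬ = ⊔-⌟ ; ⊔-⌟ = ⊓-¬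
  ; ⊓⊔-interchange = λ x → sym (⊓⊔-interchange x)
  }
  where open DCoreAlgebra A

theorem3p12 : {a : Level} (A : DCoreAlgebra a) → let open DCoreAlgebra A in ∀ x y z → (x ⊓ (y ⊓ z) ≡ (x ⊓ y) ⊓ z) × (x ⊔ (y ⊔ z) ≡ (x ⊔ y) ⊔ z)
theorem3p12 A x y z =
  DCoreAlgebraProperties.⊓-assoc A x y z , DCoreAlgebraProperties.⊓-assoc (dual A) x y z
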